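{- Let $X$ be a state of a graph $G$. If every follower of $X$ is an associate of an odd-moves state of $G$, then $g(X)=0$. If every follower of $X$ is an associate of an even-moves follower of $X$, then $g(X)=1$.
   Context: Graphs are simple without isolated vertices. A decoration is a set of arrows on edges, at most one per edge; a vertex is a sink (source) if all its edges carry arrows into (out of) it; a state is a decoration with no sink or source at a vertex of degree $\ge2$. A follower of a state $X$ is a state $X\cup\{(v,w)\}$ with $\{v,w\}$ unmarked in $X$; descendents are iterated followers; terminal = no followers. Grundy value $g(X)=\mathrm{mex}\{g(Y):Y\text{ follower of }X\}$. A state $X$ is an even-moves (odd-moves) state if for every terminal state $X^*$ equal to $X$ or a descendent of $X$, $|X^*\setminus X|$ is even (odd). Two states of $G$ are associates if they have a common follower. -}

module Defs where

open import Data.Nat using (ℕ; zero; suc; _*_; _<ᵇ_; _≡ᵇ_)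
open import Data.Nat.Divisibility using (_∣_)
open import Data.Bool using (Bool; true; false; _∧_; _∨_; not; if_then_else_)
open import Data.Fin using (Fin; _≟_)
open import Data.List using (List; []; _∷_; length; map; filterᵇ; allFin; concatMap)
open import Data.Bool.ListAction using (all; any)
open import Data.Product using (Σ; _×_; _,_; ∃; ∃-syntax)
open import Relation.Binary.PropositionalEquality using (_≡_)
open import Relation.Nullary using (¬_)
open import Relation.Nullary.Decidable using (⌊_⌋)

record Graph : Set where
  field
    n          : ℕ
    adj        : Fin n → Fin n → Bool
    symm       : ∀ v w → adj v w ≡ adj w v
    irrefl     : ∀ v → adj v v ≡ false
    noIsolated : ∀ v → ∃[ w ] adj v w ≡ true

open Graph public

module _ (G : Graph) where

  -- A set of arrows: A v w = true means the arrow (v , w), i.e. v → w.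
  Arrows : Set
  Arrows = Fin (n G) → Fin (n G) → Bool

  vertices : List (Fin (n G))
  vertices = allFin (n G)

  pairs : List (Fin (n G) × Fin (n G))
  pairs = concatMap (λ v → map (λ w → (v , w)) vertices) vertices

  degree : Fin (n G) → ℕ
  degree v = length (filterᵇ (adj G v) vertices)

  -- decoration: arrows only on edges, at most one arrow per edge
  isDecorationᵇ : Arrows → Bool
  isDecorationᵇ A = all (λ p → not (A (Data.Product.proj₁ p) (Data.Product.proj₂ p))
                         ∨ (adj G (Data.Product.proj₁ p) (Data.Product.proj₂ p)
                            ∧ not (A (Data.Product.proj₂ p) (Data.Product.proj₁ p)))) pairs

  isSinkᵇ : Arrows → Fin (n G) → Bool
  isSinkᵇ A v = all (λ w → not (adj G v w) ∨ A w v) vertices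

  isSourceᵇ : Arrows → Fin (n G) → Bool
  isSourceᵇ A v = all (λ w → not (adj G v w) ∨ A v w) vertices

  isStateᵇ : Arrows → Bool
  isStateᵇ A = isDecorationᵇ A
    ∧ all (λ v → (degree v <ᵇ 2) ∨ (not (isSinkᵇ A v) ∧ not (isSourceᵇ A v))) vertices

  IsState : Arrows → Set
  IsState A = isStateᵇ A ≡ true

  addArrow : Arrows → Fin (n G) → Fin (n G) → Arrows
  addArrow A v w a b = A a b ∨ (⌊ a ≟ v ⌋ ∧ ⌊ b ≟ w ⌋)

  unmarkedᵇ : Arrows → Fin (n G) → Fin (n G) → Bool
  unmarkedᵇ A v w = adj G v w ∧ not (A v w) ∧ not (A w v)

  Follower : Arrows → Arrows → Set
  Follower X Y = Σ (Fin (n G)) λ v → Σ (Fin (n G)) λ w →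
      unmarkedᵇ X v w ≡ true
    × IsState (addArrow X v w)
    × (∀ a b → Y a b ≡ addArrow X v w a b)

  Terminal : Arrows → Set
  Terminal X = ∀ Y → ¬ Follower X Y

  data EqOrDescendent (X : Arrows) : Arrows → Set where
    here : ∀ {Y} → (∀ a b → Y a b ≡ X a b) → EqOrDescendent X Y
    step : ∀ {Z Y} → Follower X Z → EqOrDescendent Z Y → EqOrDescendent X Y

  diffSize : Arrows → Arrows → ℕ
  diffSize Y X = length (filterᵇ (λ p → Y (Data.Product.proj₁ p) (Data.Product.proj₂ p)
                                     ∧ not (X (Data.Product.proj₁ p) (Data.Product.proj₂ p))) pairs)

  EvenMovesState : Arrows → Set
  EvenMovesState X = IsState X ×
    (∀ X* → EqOrDescendent X X* → Terminal X* → 2 ∣ diffSize X* X)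

  OddMovesState : Arrows → Set
  OddMovesState X = IsState X ×
    (∀ X* → EqOrDescendent X X* → Terminal X* → ¬ (2 ∣ diffSize X* X))

  Associates : Arrows → Arrows → Set
  Associates X Y = IsState X × IsState Y × (∃[ Z ] (Follower X Z × Follower Y Z))

  mexFrom : ℕ → ℕ → List ℕ → ℕ
  mexFrom zero    k xs = k
  mexFrom (suc f) k xs = if any (λ x → x ≡ᵇ k) xs then mexFrom f (suc k) xs else k

  mex : List ℕ → ℕ
  mex xs = mexFrom (length xs) 0 xs

  followerMoves : Arrows → List (Fin (n G) × Fin (n G))
  followerMoves A = filterᵇ (λ p → unmarkedᵇ A (Data.Product.proj₁ p) (Data.Product.proj₂ p)
                                   ∧ isStateᵇ (addArrow A (Data.Product.proj₁ p) (Data.Product.proj₂ p))) pairs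

  -- Grundy value with fuel; each move marks a previously unmarked edge, so
  -- the game from any decoration lasts fewer than n*n moves, and fuel n*n
  -- suffices for grundyF to compute the genuine recursive mex.
  grundyF : ℕ → Arrows → ℕ
  grundyF zero    A = 0
  grundyF (suc k) A = mex (map (λ p → grundyF k (addArrow A (Data.Product.proj₁ p) (Data.Product.proj₂ p)))
                               (followerMoves A))

  grundy : Arrows → ℕ
  grundy A = grundyF (n G * n G) A

module Submission where

-- Every move adds exactly one arrow, so the number of absent arrows drops by one
-- along each play and |D \ A| is the length of any play from A to D.  Hence a
-- follower of an even-moves state is an odd-moves state and vice versa, and by
-- induction even-moves states have Grundy value 0 while odd-moves states, which
-- are never terminal, have Grundy value 1.  If a follower Y of X is associated
-- with Z, their common follower W is also a follower of Z: when Z is odd-moves,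
-- W is even-moves, so g(W) = 0 and g(Y) ≠ 0; when Z is even-moves, g(W) = 1 and
-- g(Y) ≠ 1.  So in the first case 0 is not a Grundy value of a follower of X, and
-- in the second 0 is (at an even-moves follower) while 1 is not.

open import Defs
open import Data.Bool using (Bool; true; false; _∧_; _∨_; not; T)
open import Data.Bool.ListAction using (and; all; any)
open import Data.Bool.Properties using (∧-comm; ∧-inverseʳ; ∨-identityʳ)
open import Data.Empty using (⊥-elim)
open import Data.Fin using (Fin; _≟_)
open import Data.List using (List; []; _∷_; _++_; length; map; filterᵇ; allFin; concatMap; cartesianProduct)
open import Data.List.Membership.Propositional using (_∈_; _∉_)
open import Data.List.Membership.Propositional.Properties
  using (∉[]; ∈-allFin; ∈-cartesianProduct⁺; ∈-map⁺; ∈-map⁻; ∈-filter⁺; ∈-filter⁻)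
open import Data.List.Properties using (map-cong; map-cong-local; map-tabulate; length-++; length-map; length-tabulate; length-filter; filter-++)
import Data.List.Relation.Unary.All as All
open import Data.List.Relation.Unary.Any as Any using (here)
open import Data.List.Relation.Unary.Any.Properties using (any⁺; any⁻)
open import Data.Nat using (ℕ; zero; suc; _+_; _*_; _≤_; _<_; _≡ᵇ_; _<ᵇ_; s≤s⁻¹)
open import Data.List.Membership.DecPropositional Data.Nat._≟_ using (_∈?_)
open import Data.Nat.Divisibility using (_∣_; _∣0; ∣-refl; ∣1⇒≡1; ∣m∣n⇒∣m+n; ∣m+n∣m⇒∣n)
open import Data.Nat.Induction using (<-wellFounded)
open import Data.Nat.Properties using (≤-refl; ≤-trans; ≤-reflexive; >⇒≢; n≤1+n; +-comm; +-suc; +-cancelʳ-≡; ≡⇒≡ᵇ; ≡ᵇ⇒≡; module ≤-Reasoning)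
open import Data.Product using (_×_; _,_; proj₁; proj₂; ∃-syntax)
open import Data.Sum using (_⊎_; inj₁; inj₂)
open import Function using (_∘_; case_of_)
open import Induction.WellFounded using (Acc; acc)
open import Relation.Binary.PropositionalEquality
open import Relation.Nullary using (¬_; yes; no; contradiction)
open import Relation.Nullary.Decidable using (⌊_⌋)

-- Counting with Boolean predicates

module _ {A : Set} where

  countᵇ : (A → Bool) → List A → ℕ
  countᵇ p xs = length (filterᵇ p xs)

  filterᵇ-cong : ∀ {p q : A → Bool} → (∀ x → p x ≡ q x) → ∀ xs → filterᵇ p xs ≡ filterᵇ q xs
  filterᵇ-cong e [] = refl
  filterᵇ-cong {p} {q} e (x ∷ xs) with p x | q x | e x
  ... | true  | .true  | refl = cong (x ∷_) (filterᵇ-cong e xs)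
  ... | false | .false | refl = filterᵇ-cong e xs

  all-cong : ∀ {p q : A → Bool} → (∀ x → p x ≡ q x) → ∀ xs → all p xs ≡ all q xs
  all-cong e xs = cong and (map-cong e xs)

  countᵇ-cong : ∀ {p q : A → Bool} → (∀ x → p x ≡ q x) → ∀ xs → countᵇ p xs ≡ countᵇ q xs
  countᵇ-cong e xs = cong length (filterᵇ-cong e xs)

  countᵇ-split : ∀ (p q : A → Bool) xs →
    countᵇ p xs ≡ countᵇ (λ x → p x ∧ q x) xs + countᵇ (λ x → p x ∧ not (q x)) xs
  countᵇ-split p q [] = refl
  countᵇ-split p q (x ∷ xs) with p x | q x
  ... | true  | true  = cong suc (countᵇ-split p q xs)
  ... | true  | false = trans (cong suc (countᵇ-split p q xs)) (sym (+-suc _ _))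
  ... | false | _     = countᵇ-split p q xs

  countᵇ-none : ∀ (p : A → Bool) → (∀ x → p x ≡ false) → ∀ xs → countᵇ p xs ≡ 0
  countᵇ-none p e xs = trans (countᵇ-cong e xs) (countᵇ-false xs)
    where
    countᵇ-false : ∀ xs → countᵇ (λ _ → false) xs ≡ 0
    countᵇ-false [] = refl
    countᵇ-false (_ ∷ xs) = countᵇ-false xs

  countᵇ-++ : ∀ (p : A → Bool) xs ys → countᵇ p (xs ++ ys) ≡ countᵇ p xs + countᵇ p ys
  countᵇ-++ p xs ys = trans (cong length (filter-++ _ xs ys)) (length-++ (filterᵇ p xs))

  countᵇ≤length : ∀ (p : A → Bool) xs → countᵇ p xs ≤ length xs
  countᵇ≤length p xs = length-filter _ xs

countᵇ-map : ∀ {A B : Set} (p : B → Bool) (f : A → B) xs → countᵇ p (map f xs) ≡ countᵇ (λ x → p (f x)) xs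
countᵇ-map p f [] = refl
countᵇ-map p f (x ∷ xs) with p (f x)
... | true  = cong suc (countᵇ-map p f xs)
... | false = countᵇ-map p f xs

countᵇ-cartesianProduct : ∀ {A B : Set} (r : A → Bool) (q : B → Bool) xs ys →
  countᵇ (λ p → r (proj₁ p) ∧ q (proj₂ p)) (cartesianProduct xs ys) ≡ countᵇ r xs * countᵇ q ys
countᵇ-cartesianProduct r q [] ys = refl
countᵇ-cartesianProduct r q (x ∷ xs) ys = begin
  countᵇ P (map (x ,_) ys ++ cartesianProduct xs ys)
    ≡⟨ countᵇ-++ P (map (x ,_) ys) (cartesianProduct xs ys) ⟩
  countᵇ P (map (x ,_) ys) + countᵇ P (cartesianProduct xs ys)
    ≡⟨ cong₂ _+_ (countᵇ-map P (x ,_) ys) (countᵇ-cartesianProduct r q xs ys) ⟩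
  countᵇ (λ y → r x ∧ q y) ys + countᵇ r xs * countᵇ q ys
    ≡⟨ first-row ⟩
  countᵇ r (x ∷ xs) * countᵇ q ys ∎
  where
  open ≡-Reasoning
  P = λ p → r (proj₁ p) ∧ q (proj₂ p)
  first-row : countᵇ (λ y → r x ∧ q y) ys + countᵇ r xs * countᵇ q ys ≡ countᵇ r (x ∷ xs) * countᵇ q ys
  first-row with r x
  ... | true  = refl
  ... | false = cong (_+ countᵇ r xs * countᵇ q ys) (countᵇ-none _ (λ _ → refl) ys)

concatMap-pairs≡cartesianProduct : ∀ {A B : Set} (xs : List A) (ys : List B) →
  concatMap (λ x → map (λ y → (x , y)) ys) xs ≡ cartesianProduct xs ys
concatMap-pairs≡cartesianProduct [] ys = refl
concatMap-pairs≡cartesianProduct (x ∷ xs) ys = cong (map (x ,_) ys ++_) (concatMap-pairs≡cartesianProduct xs ys)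

length-cartesianProduct : ∀ {A B : Set} (xs : List A) (ys : List B) →
  length (cartesianProduct xs ys) ≡ length xs * length ys
length-cartesianProduct [] ys = refl
length-cartesianProduct (x ∷ xs) ys =
  trans (length-++ (map (x ,_) ys)) (cong₂ _+_ (length-map (x ,_) ys) (length-cartesianProduct xs ys))

countᵇ-≟-allFin : ∀ {m} (v : Fin m) → countᵇ (λ a → ⌊ a ≟ v ⌋) (allFin m) ≡ 1
countᵇ-≟-allFin {suc m} v rewrite sym (map-tabulate {n = m} (λ a → a) Fin.suc) with v
... | Fin.zero  = cong suc (trans (countᵇ-map _ Fin.suc (allFin m)) (countᵇ-none _ (λ _ → refl) (allFin m)))
... | Fin.suc v = trans (countᵇ-map _ Fin.suc (allFin m)) (trans (countᵇ-cong ≟-suc (allFin m)) (countᵇ-≟-allFin v))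
  where
  ≟-suc : ∀ a → ⌊ Fin.suc a ≟ Fin.suc v ⌋ ≡ ⌊ a ≟ v ⌋
  ≟-suc a with a ≟ v
  ... | yes _ = refl
  ... | no  _ = refl

2∣n⊎2∣1+n : ∀ n → 2 ∣ n ⊎ 2 ∣ suc n
2∣n⊎2∣1+n zero = inj₁ (2 ∣0)
2∣n⊎2∣1+n (suc n) with 2∣n⊎2∣1+n n
... | inj₁ 2∣n   = inj₂ (∣m∣n⇒∣m+n ∣-refl 2∣n)
... | inj₂ 2∣1+n = inj₁ 2∣1+n

2∣1+n⇒2∤n : ∀ {n} → 2 ∣ suc n → ¬ 2 ∣ n
2∣1+n⇒2∤n {n} 2∣1+n 2∣n with ∣1⇒≡1 (∣m+n∣m⇒∣n (subst (2 ∣_) (+-comm 1 n) 2∣1+n) 2∣n)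
... | ()

2∤1+n⇒2∣n : ∀ {n} → ¬ 2 ∣ suc n → 2 ∣ n
2∤1+n⇒2∣n {n} 2∤1+n with 2∣n⊎2∣1+n n
... | inj₁ 2∣n   = 2∣n
... | inj₂ 2∣1+n = contradiction 2∣1+n 2∤1+n

-- Minimal excludants

∈⇒any≡ᵇ : ∀ {k xs} → k ∈ xs → T (any (_≡ᵇ k) xs)
∈⇒any≡ᵇ = any⁺ _ ∘ Any.map (λ {x} k≡x → ≡⇒≡ᵇ x _ (sym k≡x))

any≡ᵇ⇒∈ : ∀ {k} xs → T (any (_≡ᵇ k) xs) → k ∈ xs
any≡ᵇ⇒∈ xs = Any.map (λ {x} x≡ᵇk → sym (≡ᵇ⇒≡ x _ x≡ᵇk)) ∘ any⁻ _ xs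

module _ (G : Graph) where

  private
    V : Set
    V = Fin (n G)

  mexFrom-∈ : ∀ f {k xs} → k ∈ xs → mexFrom G (suc f) k xs ≡ mexFrom G f (suc k) xs
  mexFrom-∈ f {k} {xs} k∈xs with any (_≡ᵇ k) xs in eq
  ... | true  = refl
  ... | false = contradiction (subst T eq (∈⇒any≡ᵇ k∈xs)) λ ()

  mexFrom-∉ : ∀ f {k xs} → k ∉ xs → mexFrom G (suc f) k xs ≡ k
  mexFrom-∉ f {k} {xs} k∉xs with any (_≡ᵇ k) xs in eq
  ... | true  = contradiction (any≡ᵇ⇒∈ xs (subst T (sym eq) _)) k∉xs
  ... | false = refl

  mexFrom-≥ : ∀ f k xs → k ≤ mexFrom G f k xs
  mexFrom-≥ zero k xs = ≤-refl
  mexFrom-≥ (suc f) k xs with any (_≡ᵇ k) xs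
  ... | true  = ≤-trans (n≤1+n k) (mexFrom-≥ f (suc k) xs)
  ... | false = ≤-refl

  mex≡0 : ∀ {xs} → 0 ∉ xs → mex G xs ≡ 0
  mex≡0 {[]}     _    = refl
  mex≡0 {x ∷ xs} 0∉xs = mexFrom-∉ (length xs) 0∉xs

  mex≢0 : ∀ {xs} → 0 ∈ xs → mex G xs ≢ 0
  mex≢0 {x ∷ xs} 0∈xs =
    >⇒≢ (subst (0 <_) (sym (mexFrom-∈ (length xs) 0∈xs)) (mexFrom-≥ (length xs) 1 (x ∷ xs)))

  mex≡1 : ∀ {xs} → 0 ∈ xs → 1 ∉ xs → mex G xs ≡ 1
  mex≡1 {x ∷ []}     0∈xs 1∉xs = mexFrom-∈ 0 0∈xs
  mex≡1 {x ∷ y ∷ xs} 0∈xs 1∉xs = trans (mexFrom-∈ (suc (length xs)) 0∈xs) (mexFrom-∉ (length xs) 1∉xs)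

  mex≢1 : ∀ {xs} → 1 ∈ xs → mex G xs ≢ 1
  mex≢1 {xs} 1∈xs with 0 ∈? xs
  mex≢1 {_ ∷ []}     (here refl) | yes (here ())
  mex≢1 {x ∷ y ∷ xs} 1∈xs        | yes 0∈xs = >⇒≢ (subst (1 <_) (sym mex≡mexFrom2) (mexFrom-≥ (length xs) 2 (x ∷ y ∷ xs)))
    where
    mex≡mexFrom2 : mex G (x ∷ y ∷ xs) ≡ mexFrom G (length xs) 2 (x ∷ y ∷ xs)
    mex≡mexFrom2 = trans (mexFrom-∈ (suc (length xs)) 0∈xs) (mexFrom-∈ (length xs) 1∈xs)
  mex≢1 {xs}         _           | no 0∉xs  = subst (_≢ 1) (sym (mex≡0 0∉xs)) λ ()

  -- Decorations and their followers

  _≈_ : Arrows G → Arrows G → Set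
  A ≈ B = ∀ a b → A a b ≡ B a b

  _⊆_ : Arrows G → Arrows G → Set
  A ⊆ B = ∀ a b → A a b ≡ true → B a b ≡ true

  move : Arrows G → V × V → Arrows G
  move A p = addArrow G A (proj₁ p) (proj₂ p)

  isStateᵇ-cong : ∀ {A B} → A ≈ B → isStateᵇ G A ≡ isStateᵇ G B
  isStateᵇ-cong {A} {B} A≈B = cong₂ _∧_
    (all-cong (λ (a , b) → cong₂ (λ s t → not s ∨ (adj G a b ∧ not t)) (A≈B a b) (A≈B b a)) (pairs G))
    (all-cong (λ v → cong₂ (λ s t → (degree G v <ᵇ 2) ∨ (not s ∧ not t)) (sink-cong v) (source-cong v)) (vertices G))
    where
    sink-cong : ∀ v → isSinkᵇ G A v ≡ isSinkᵇ G B v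
    sink-cong v = all-cong (λ w → cong (not (adj G v w) ∨_) (A≈B w v)) (vertices G)
    source-cong : ∀ v → isSourceᵇ G A v ≡ isSourceᵇ G B v
    source-cong v = all-cong (λ w → cong (not (adj G v w) ∨_) (A≈B v w)) (vertices G)

  addArrow-cong : ∀ {A B} → A ≈ B → ∀ v w → addArrow G A v w ≈ addArrow G B v w
  addArrow-cong A≈B v w a b = cong (_∨ (⌊ a ≟ v ⌋ ∧ ⌊ b ≟ w ⌋)) (A≈B a b)

  followerMoves-cong : ∀ {A B} → A ≈ B → followerMoves G A ≡ followerMoves G B
  followerMoves-cong A≈B = filterᵇ-cong
    (λ (v , w) → cong₂ _∧_ (cong₂ (λ s t → adj G v w ∧ not s ∧ not t) (A≈B v w) (A≈B w v))
                           (isStateᵇ-cong (addArrow-cong A≈B v w)))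
    (pairs G)

  grundyF-cong : ∀ {A B} → A ≈ B → ∀ k → grundyF G k A ≡ grundyF G k B
  grundyF-cong A≈B zero = refl
  grundyF-cong {A} {B} A≈B (suc k) = cong (mex G) (begin
    map (grundyF G k ∘ move A) (followerMoves G A) ≡⟨ cong (map _) (followerMoves-cong A≈B) ⟩
    map (grundyF G k ∘ move A) (followerMoves G B) ≡⟨ map-cong (λ (v , w) → grundyF-cong (addArrow-cong A≈B v w) k) _ ⟩
    map (grundyF G k ∘ move B) (followerMoves G B) ∎)
    where open ≡-Reasoning

  grundy-cong : ∀ {A B} → A ≈ B → grundy G A ≡ grundy G B
  grundy-cong A≈B = grundyF-cong A≈B (n G * n G)

  follower-isState : ∀ {A W} → Follower G A W → IsState G W
  follower-isState (v , w , _ , isState , W≈) = trans (isStateᵇ-cong W≈) isState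

  follower-⊆ : ∀ {A W} → Follower G A W → A ⊆ W
  follower-⊆ (v , w , _ , _ , W≈) a b Aab rewrite W≈ a b | Aab = refl

  descendent-⊆ : ∀ {A D} → EqOrDescendent G A D → A ⊆ D
  descendent-⊆ (here D≈A)  a b Aab = trans (D≈A a b) Aab
  descendent-⊆ (step f d) a b Aab = descendent-⊆ d a b (follower-⊆ f a b Aab)

  ∈-pairs : ∀ v w → (v , w) ∈ pairs G
  ∈-pairs v w = subst ((v , w) ∈_) (sym (concatMap-pairs≡cartesianProduct (vertices G) (vertices G)))
                      (∈-cartesianProduct⁺ (∈-allFin v) (∈-allFin w))

  follower⇒move : ∀ {A W} → Follower G A W → ∃[ p ] p ∈ followerMoves G A × W ≈ move A p
  follower⇒move (v , w , unmarked , isState , W≈) =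
    (v , w) , ∈-filter⁺ _ (∈-pairs v w) (subst T (sym (cong₂ _∧_ unmarked isState)) _) , W≈

  move⇒follower : ∀ {A p} → p ∈ followerMoves G A → Follower G A (move A p)
  move⇒follower {A} {v , w} p∈ with unmarkedᵇ G A v w in unmarked | isStateᵇ G (addArrow G A v w) in isState
                                  | proj₂ (∈-filter⁻ _ {xs = pairs G} p∈)
  ... | true | true | _ = v , w , unmarked , isState , λ _ _ → refl

  terminal⇒followerMoves≡[] : ∀ {A} → Terminal G A → followerMoves G A ≡ []
  terminal⇒followerMoves≡[] {A} terminal with followerMoves G A in eq
  ... | []    = refl
  ... | p ∷ _ = ⊥-elim (terminal _ (move⇒follower (subst (p ∈_) (sym eq) (here refl))))

  ¬terminal⇒follower : ∀ {A} → ¬ Terminal G A → ∃[ W ] Follower G A W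
  ¬terminal⇒follower {A} ¬terminal with followerMoves G A in eq
  ... | []    = contradiction (λ W f → case follower⇒move f of λ { (_ , p∈ , _) → ∉[] (subst (_ ∈_) eq p∈) }) ¬terminal
  ... | p ∷ _ = move A p , move⇒follower (subst (p ∈_) (sym eq) (here refl))

  -- Counting arrows

  absentArrows : Arrows G → ℕ
  absentArrows A = countᵇ (λ (a , b) → not (A a b)) (pairs G)

  absentArrows≤ : ∀ A → absentArrows A ≤ n G * n G
  absentArrows≤ A = begin
    absentArrows A          ≤⟨ countᵇ≤length _ (pairs G) ⟩
    length (pairs G)        ≡⟨ cong length (concatMap-pairs≡cartesianProduct (vertices G) (vertices G)) ⟩
    length (cartesianProduct (vertices G) (vertices G))
                            ≡⟨ length-cartesianProduct (vertices G) (vertices G) ⟩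
    length (vertices G) * length (vertices G)
                            ≡⟨ cong₂ _*_ (length-tabulate {n = n G} (λ v → v)) (length-tabulate {n = n G} (λ v → v)) ⟩
    n G * n G               ∎
    where open ≤-Reasoning

  diffSize+absentArrows : ∀ {A D} → A ⊆ D → diffSize G D A + absentArrows D ≡ absentArrows A
  diffSize+absentArrows {A} {D} A⊆D = sym (trans (countᵇ-split ¬A D′ (pairs G)) (cong₂ _+_
    (countᵇ-cong (λ (a , b) → ∧-comm (not (A a b)) (D a b)) (pairs G))
    (countᵇ-cong (λ (a , b) → absent-in-D (A a b) (D a b) (A⊆D a b)) (pairs G))))
    where
    ¬A D′ : V × V → Bool
    ¬A (a , b) = not (A a b)
    D′ (a , b) = D a b
    absent-in-D : ∀ x y → (x ≡ true → y ≡ true) → not x ∧ not y ≡ not y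
    absent-in-D true  true  _   = refl
    absent-in-D true  false x⇒y = contradiction (x⇒y refl) λ ()
    absent-in-D false _     _   = refl

  diffSize-refl : ∀ A → diffSize G A A ≡ 0
  diffSize-refl A = countᵇ-none _ (λ (a , b) → ∧-inverseʳ (A a b)) (pairs G)

  unmarked⇒noArrow : ∀ A v w → unmarkedᵇ G A v w ≡ true → A v w ≡ false
  unmarked⇒noArrow A v w unmarked with adj G v w | A v w | unmarked
  ... | true | false | _ = refl

  diffSize-follower : ∀ {A W} → Follower G A W → diffSize G W A ≡ 1
  diffSize-follower {A} {W} (v , w , unmarked , _ , W≈) = begin
    diffSize G W A
      ≡⟨ countᵇ-cong (λ (a , b) → trans (cong (_∧ not (A a b)) (W≈ a b)) (new-arrow a b)) (pairs G) ⟩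
    countᵇ (λ (a , b) → ⌊ a ≟ v ⌋ ∧ ⌊ b ≟ w ⌋) (pairs G)
      ≡⟨ cong (countᵇ _) (concatMap-pairs≡cartesianProduct (vertices G) (vertices G)) ⟩
    countᵇ (λ (a , b) → ⌊ a ≟ v ⌋ ∧ ⌊ b ≟ w ⌋) (cartesianProduct (vertices G) (vertices G))
      ≡⟨ countᵇ-cartesianProduct (λ a → ⌊ a ≟ v ⌋) (λ b → ⌊ b ≟ w ⌋) (vertices G) (vertices G) ⟩
    countᵇ (λ a → ⌊ a ≟ v ⌋) (vertices G) * countᵇ (λ b → ⌊ b ≟ w ⌋) (vertices G)
      ≡⟨ cong₂ _*_ (countᵇ-≟-allFin v) (countᵇ-≟-allFin w) ⟩
    1 ∎
    where
    open ≡-Reasoning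
    new-arrow : ∀ a b → addArrow G A v w a b ∧ not (A a b) ≡ ⌊ a ≟ v ⌋ ∧ ⌊ b ≟ w ⌋
    new-arrow a b with a ≟ v | b ≟ w
    ... | yes refl | yes refl rewrite unmarked⇒noArrow A v w unmarked = refl
    ... | yes _    | no _  = trans (cong (_∧ not (A a b)) (∨-identityʳ (A a b))) (∧-inverseʳ (A a b))
    ... | no _     | _     = trans (cong (_∧ not (A a b)) (∨-identityʳ (A a b))) (∧-inverseʳ (A a b))

  absentArrows-follower : ∀ {A W} → Follower G A W → absentArrows A ≡ suc (absentArrows W)
  absentArrows-follower {A} {W} f =
    trans (sym (diffSize+absentArrows (follower-⊆ f))) (cong (_+ absentArrows W) (diffSize-follower f))

  absentArrows-follower< : ∀ {A W} → Follower G A W → absentArrows W < absentArrows A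
  absentArrows-follower< f = ≤-reflexive (sym (absentArrows-follower f))

  diffSize-follower-descendent : ∀ {A W D} → Follower G A W → EqOrDescendent G W D →
    diffSize G D A ≡ suc (diffSize G D W)
  diffSize-follower-descendent {A} {W} {D} f d = +-cancelʳ-≡ (absentArrows D) _ _ (begin
    diffSize G D A + absentArrows D        ≡⟨ diffSize+absentArrows (descendent-⊆ (step f d)) ⟩
    absentArrows A                         ≡⟨ absentArrows-follower f ⟩
    suc (absentArrows W)                   ≡⟨ cong suc (diffSize+absentArrows (descendent-⊆ d)) ⟨
    suc (diffSize G D W + absentArrows D)  ∎)
    where open ≡-Reasoning

  move-absentArrows≤ : ∀ {A p k} → p ∈ followerMoves G A → absentArrows A ≤ suc k → absentArrows (move A p) ≤ k
  move-absentArrows≤ p∈ A≤1+k = s≤s⁻¹ (≤-trans (absentArrows-follower< (move⇒follower p∈)) A≤1+k)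

  -- Grundy values

  absentArrows≤0⇒terminal : ∀ {A} → absentArrows A ≤ 0 → Terminal G A
  absentArrows≤0⇒terminal A≤0 W f = contradiction (≤-trans (absentArrows-follower< f) A≤0) λ ()

  grundyF-stable : ∀ k A → absentArrows A ≤ k → grundyF G (suc k) A ≡ grundyF G k A
  grundyF-stable zero A A≤0 =
    cong (mex G ∘ map _) (terminal⇒followerMoves≡[] (absentArrows≤0⇒terminal A≤0))
  grundyF-stable (suc k) A A≤1+k =
    cong (mex G) (map-cong-local (All.tabulate λ p∈ → grundyF-stable k _ (move-absentArrows≤ p∈ A≤1+k)))

  grundyF-unfold : ∀ k A → absentArrows A ≤ k →
    grundyF G k A ≡ mex G (map (grundyF G k ∘ move A) (followerMoves G A))
  grundyF-unfold zero A A≤0 =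
    sym (cong (mex G ∘ map _) (terminal⇒followerMoves≡[] (absentArrows≤0⇒terminal A≤0)))
  grundyF-unfold (suc k) A A≤1+k =
    cong (mex G) (map-cong-local (All.tabulate λ p∈ → sym (grundyF-stable k _ (move-absentArrows≤ p∈ A≤1+k))))

  followerValues : Arrows G → List ℕ
  followerValues A = map (grundy G ∘ move A) (followerMoves G A)

  grundy-unfold : ∀ A → grundy G A ≡ mex G (followerValues A)
  grundy-unfold A = grundyF-unfold (n G * n G) A (absentArrows≤ A)

  ∈-followerValues⁺ : ∀ {A W} → Follower G A W → grundy G W ∈ followerValues A
  ∈-followerValues⁺ {A} f with follower⇒move f
  ... | p , p∈ , W≈ = subst (_∈ followerValues A) (sym (grundy-cong W≈)) (∈-map⁺ (grundy G ∘ move A) p∈)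

  ∈-followerValues⁻ : ∀ {A x} → x ∈ followerValues A → ∃[ W ] Follower G A W × grundy G W ≡ x
  ∈-followerValues⁻ {A} x∈ with ∈-map⁻ (grundy G ∘ move A) x∈
  ... | p , p∈ , x≡ = move A p , move⇒follower p∈ , sym x≡

  grundy≡0 : ∀ {A} → (∀ {W} → Follower G A W → grundy G W ≢ 0) → grundy G A ≡ 0
  grundy≡0 {A} noZero = trans (grundy-unfold A) (mex≡0 λ 0∈ → case ∈-followerValues⁻ 0∈ of λ
    { (W , f , grundyW≡0) → noZero f grundyW≡0 })

  grundy≢0 : ∀ {A W} → Follower G A W → grundy G W ≡ 0 → grundy G A ≢ 0
  grundy≢0 {A} f grundyW≡0 =
    subst (_≢ 0) (sym (grundy-unfold A)) (mex≢0 (subst (_∈ followerValues A) grundyW≡0 (∈-followerValues⁺ f)))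

  grundy≡1 : ∀ {A Z} → Follower G A Z → grundy G Z ≡ 0 → (∀ {W} → Follower G A W → grundy G W ≢ 1) →
    grundy G A ≡ 1
  grundy≡1 {A} f grundyZ≡0 noOne = trans (grundy-unfold A) (mex≡1
    (subst (_∈ followerValues A) grundyZ≡0 (∈-followerValues⁺ f))
    λ 1∈ → case ∈-followerValues⁻ 1∈ of λ { (W , f , grundyW≡1) → noOne f grundyW≡1 })

  grundy≢1 : ∀ {A W} → Follower G A W → grundy G W ≡ 1 → grundy G A ≢ 1
  grundy≢1 {A} f grundyW≡1 =
    subst (_≢ 1) (sym (grundy-unfold A)) (mex≢1 (subst (_∈ followerValues A) grundyW≡1 (∈-followerValues⁺ f)))

  even-moves-follower : ∀ {A W} → EvenMovesState G A → Follower G A W → OddMovesState G W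
  even-moves-follower (_ , even) f = follower-isState f , λ D d terminal →
    2∣1+n⇒2∤n (subst (2 ∣_) (diffSize-follower-descendent f d) (even D (step f d) terminal))

  odd-moves-follower : ∀ {A W} → OddMovesState G A → Follower G A W → EvenMovesState G W
  odd-moves-follower (_ , odd) f = follower-isState f , λ D d terminal →
    2∤1+n⇒2∣n (subst (¬_ ∘ (2 ∣_)) (diffSize-follower-descendent f d) (odd D (step f d) terminal))

  odd-moves-¬terminal : ∀ {A} → OddMovesState G A → ¬ Terminal G A
  odd-moves-¬terminal {A} (_ , odd) terminal =
    odd A (here λ _ _ → refl) terminal (subst (2 ∣_) (sym (diffSize-refl A)) (2 ∣0))

  private
    grundy-even-moves-acc : ∀ {A} → Acc _<_ (absentArrows A) → EvenMovesState G A → grundy G A ≡ 0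
    grundy-odd-moves-acc  : ∀ {A} → Acc _<_ (absentArrows A) → OddMovesState G A → grundy G A ≡ 1

    grundy-even-moves-acc (acc rs) evenA = grundy≡0 λ f grundyW≡0 → contradiction
      (trans (sym grundyW≡0) (grundy-odd-moves-acc (rs (absentArrows-follower< f)) (even-moves-follower evenA f))) λ ()

    grundy-odd-moves-acc (acc rs) oddA with ¬terminal⇒follower (odd-moves-¬terminal oddA)
    ... | Z , f = grundy≡1 f
      (grundy-even-moves-acc (rs (absentArrows-follower< f)) (odd-moves-follower oddA f))
      λ f′ grundyW≡1 → contradiction
        (trans (sym grundyW≡1) (grundy-even-moves-acc (rs (absentArrows-follower< f′)) (odd-moves-follower oddA f′))) λ ()

  grundy-even-moves : ∀ {A} → EvenMovesState G A → grundy G A ≡ 0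
  grundy-even-moves {A} = grundy-even-moves-acc (<-wellFounded (absentArrows A))

  grundy-odd-moves : ∀ {A} → OddMovesState G A → grundy G A ≡ 1
  grundy-odd-moves {A} = grundy-odd-moves-acc (<-wellFounded (absentArrows A))

mainTheorem13 : (G : Graph) (X : Arrows G) → IsState G X →
    ((∀ Y → Follower G X Y → ∃[ Z ] (OddMovesState G Z × Associates G Y Z))
      → grundy G X ≡ 0)
  × ((∃[ Y ] Follower G X Y)
      → (∀ Y → Follower G X Y → ∃[ Z ] (Follower G X Z × EvenMovesState G Z × Associates G Y Z))
      → grundy G X ≡ 1)
mainTheorem13 G X _ = part₁ , part₂
  where
  part₁ : (∀ Y → Follower G X Y → ∃[ Z ] (OddMovesState G Z × Associates G Y Z)) → grundy G X ≡ 0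
  part₁ h = grundy≡0 G λ {Y} X→Y → case h Y X→Y of λ
    { (Z , oddZ , (_ , _ , W , Y→W , Z→W)) →
        grundy≢0 G Y→W (grundy-even-moves G (odd-moves-follower G oddZ Z→W)) }

  part₂ : (∃[ Y ] Follower G X Y) →
    (∀ Y → Follower G X Y → ∃[ Z ] (Follower G X Z × EvenMovesState G Z × Associates G Y Z)) →
    grundy G X ≡ 1
  part₂ (Y₀ , X→Y₀) h = case h Y₀ X→Y₀ of λ
    { (Z₀ , X→Z₀ , evenZ₀ , _) → grundy≡1 G X→Z₀ (grundy-even-moves G evenZ₀) λ {Y} X→Y → case h Y X→Y of λ
      { (Z , _ , evenZ , (_ , _ , W , Y→W , Z→W)) →
          grundy≢1 G Y→W (grundy-odd-moves G (even-moves-follower G evenZ Z→W)) } }
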